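{- Let $n\ge 1$ and let $T\in\mathbb{T}_n$ be an ordered tree that is not the maximum element of $\mathbb{T}_n$. Then the tree returned by $\mathit{NextTree}(T)$ is an ordered tree (and belongs to $\mathbb{T}_n$).
   Context: Let $\mathbb{T}$ be the set of finite rooted trees in which every internal node has at least two children. For a node $v$, $T(v)$ is the subtree rooted at $v$ and $l(v)$ the number of leaves of $T(v)$; $\mathbb{T}_n=\{T\in\mathbb{T}:l(\mathrm{root}(T))=n\}$. For an integer $p\ge 2$, $\mathrm{Part}(p)$ is the set of non-decreasing sequences $(a_1,\dots,a_k)$ of positive integers with $k\ge 2$ and $\sum_i a_i=p$, ordered lexicographically: for distinct $a=(a_i)_k$, $b=(b_i)_m$, let $j$ be the least index $\le\min\{k,m\}$ with $a_j\ne b_j$; then $a<b$ iff $a_j<b_j$. Its maximum is $(\lfloor p/2\rfloor,\lceil p/2\rceil)$. Node comparison: define, by induction on the number of leaves, a comparison between nodes $v,w$ (of the same or different trees of $\mathbb{T}$) with outcomes $v<w$, $v\sim w$, or $w<v$: (1) if $l(v)<l(w)$ then $v<w$ (symmetrically); (2) if $l(v)=l(w)=1$ then $v\sim w$; (3) if $l(v)=l(w)\ge 2$, list the children of $v$ as $v_1,\dots,v_k$ and those of $w$ as $w_1,\dots,w_m$, each list non-decreasing with respect to this comparison (already defined for them); $(l(v_1),\dots,l(v_k))$ and $(l(w_1),\dots,l(w_m))\in\mathrm{Part}(l(v))$ are the partitions induced by $v$ and $w$. (3.1) If the partition induced by $v$ is lexicographically smaller (resp. larger) than that induced by $w$ then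 $v<w$ (resp. $w<v$). (3.2) If equal (so $k=m$): if $v_i\sim w_i$ for all $i$ then $v\sim w$; otherwise, with $j$ least such that $v_j\not\sim w_j$, $v<w$ if $v_j<w_j$ and $w<v$ otherwise. Write $v\le w$ if $v<w$ or $v\sim w$. For $T_1,T_2\in\mathbb{T}_n$, compare $T_1,T_2$ by comparing their roots; $T$ is the maximum element of $\mathbb{T}_n$ if $T'\le T$ for all $T'\in\mathbb{T}_n$. An ordered tree is a tree in $\mathbb{T}$ together with, for every internal node, an arrangement of its children as a sequence $v_1,\dots,v_k$ with $v_1\le\dots\le v_k$. For a node $x$ with parent $p$, the siblings of $x$ after $x$ are the children of $p$ arranged after $x$; the root has no siblings. A node $v$ is exhausted if it is a leaf or its induced partition is the maximum of $\mathrm{Part}(l(v))$. The inverted post-order traversal of an ordered tree traverses, for the root with children $v_1,\dots,v_k$ in their arrangement, the subtrees $T(v_k),T(v_{k-1}),\dots,T(v_1)$ recursively in inverted post-order and then visits the root. The pivot is the first visited node that is not exhausted, if any. Procedure $\mathit{NextTree}$, on input an ordered tree $T\in\mathbb{T}_n$: (i) find the pivot $v$; if none, return null. (ii) Let $b=(b_1,\dots,b_m)$ be the element of $\mathrm{Part}(l(v))$ immediately next (in lexicographic order) to the partition induced by $v$. Replace $T(v)$ by the subtree in which $v$ has children $u_1,\dots,u_m$, arranged in this order, where $u_i$ is a leaf if $b_i=1$ and otherwise $u_i$ has exactly $b_i$ children, all leaves. (iii) Set $x:=v$ and repeat: for every sibling $y$ of $x$ after $x$, if $l(y)=l(x)$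 replace $T(y)$ by a copy of the current $T(x)$, and otherwise replace $T(y)$ by the tree in which $y$ has exactly $l(y)$ children, all leaves; then set $x$ to be the parent of $x$; stop after the root has been processed. (iv) Return the resulting tree (with the children arrangement as produced). -}

module Defs where

open import Data.Nat using (ℕ; zero; suc; _+_; _∸_; _≤_; _<ᵇ_; _≡ᵇ_; _/_)
open import Data.Bool using (Bool; true; false; if_then_else_; not; _∧_)
open import Data.List using (List; []; _∷_; map; length; filter; concatMap; foldr; replicate; upTo)
open import Data.List.Relation.Unary.All using (All)
open import Data.List.Relation.Unary.Linked using (Linked)
open import Data.Maybe using (Maybe; just; nothing)
open import Relation.Binary.PropositionalEquality using (_≡_; _≢_)
open import Relation.Nullary using (¬_)

-- Finite rooted trees (children given as a list = an arrangement)

data Tree : Set where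
  leaf : Tree
  node : List Tree → Tree

mutual
  leaves : Tree → ℕ
  leaves leaf      = 1
  leaves (node cs) = leavesL cs

  leavesL : List Tree → ℕ
  leavesL []       = 0
  leavesL (c ∷ cs) = leaves c + leavesL cs

mutual
  size : Tree → ℕ
  size leaf      = 1
  size (node cs) = suc (sizeL cs)

  sizeL : List Tree → ℕ
  sizeL []       = 0
  sizeL (c ∷ cs) = size c + sizeL cs

data InT : Tree → Set where
  leafT : InT leaf
  nodeT : ∀ {cs} → 2 ≤ length cs → All InT cs → InT (node cs)

-- Three-valued comparison outcomes: lt (v<w), eq (v∼w), gt (w<v)

data Cmp : Set where
  lt eq gt : Cmp

cmpℕ : ℕ → ℕ → Cmp
cmpℕ m n = if m <ᵇ n then lt else (if n <ᵇ m then gt else eq)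

lexBy : {A : Set} → (A → A → Cmp) → List A → List A → Cmp
lexBy c []       []       = eq
lexBy c []       (_ ∷ _)  = lt
lexBy c (_ ∷ _)  []       = gt
lexBy c (x ∷ xs) (y ∷ ys) with c x y
... | eq = lexBy c xs ys
... | r  = r

lexℕ : List ℕ → List ℕ → Cmp
lexℕ = lexBy cmpℕ

insertBy : {A : Set} → (A → A → Cmp) → A → List A → List A
insertBy c x []       = x ∷ []
insertBy c x (y ∷ ys) with c x y
... | gt = y ∷ insertBy c x ys
... | _  = x ∷ y ∷ ys

sortBy : {A : Set} → (A → A → Cmp) → List A → List A
sortBy c = foldr (insertBy c) []

-- The node comparison, with a fuel argument; fuel ≥ size v + size w
-- (which is what `cmpT` supplies) is always enough, since every
-- recursive call is on subtrees of strictly smaller total size.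
cmpF : ℕ → Tree → Tree → Cmp
cmpF k v w with cmpℕ (leaves v) (leaves w)
cmpF k v w | lt = lt
cmpF k v w | gt = gt
cmpF k leaf w | eq = eq
cmpF k (node cs) leaf | eq = eq
cmpF zero (node cs) (node ds) | eq = eq
cmpF (suc k) (node cs) (node ds) | eq =
  if leaves (node cs) ≡ᵇ 1 then eq else
  (let cs' = sortBy (cmpF k) cs
       ds' = sortBy (cmpF k) ds
   in  step (lexℕ (map leaves cs') (map leaves ds')) cs' ds')
  where
  step : Cmp → List Tree → List Tree → Cmp
  step eq cs' ds' = lexBy (cmpF k) cs' ds'
  step r  _   _   = r

cmpT : Tree → Tree → Cmp
cmpT v w = cmpF (size v + size w) v w

_≤T_ : Tree → Tree → Set
v ≤T w = cmpT v w ≢ gt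

sortedChildren : List Tree → List Tree
sortedChildren = sortBy cmpT

induced : Tree → List ℕ
induced leaf      = []
induced (node cs) = map leaves (sortedChildren cs)

data Ordered : Tree → Set where
  leafO : Ordered leaf
  nodeO : ∀ {cs} → 2 ≤ length cs → All Ordered cs → Linked _≤T_ cs →
          Ordered (node cs)

IsMax : ℕ → Tree → Set
IsMax n T = (T' : Tree) → InT T' → leaves T' ≡ n → T' ≤T T

-- all non-decreasing sequences of positive integers ≥ m summing to r
-- (fuel f ≥ r suffices, as each part is ≥ 1 when m ≥ 1)
ndSeqs : ℕ → ℕ → ℕ → List (List ℕ)
ndSeqs f       zero    m = [] ∷ []
ndSeqs zero    (suc r) m = []
ndSeqs (suc f) (suc r) m =
  concatMap (λ a → map (a ∷_) (ndSeqs f (suc r ∸ a) a))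
            (filter (λ a → Data.Nat._≤?_ m a) (map suc (upTo (suc r))))

allParts : ℕ → List (List ℕ)
allParts p = filter (λ a → Data.Nat._≤?_ 2 (length a)) (ndSeqs p p 1)

maxPart : ℕ → List ℕ
maxPart p = (p / 2) ∷ (p ∸ p / 2) ∷ []

eqList : List ℕ → List ℕ → Bool
eqList a b with lexℕ a b
... | eq = true
... | _  = false

isLt : Cmp → Bool
isLt lt = true
isLt _  = false

lexMin : List (List ℕ) → Maybe (List ℕ)
lexMin []       = nothing
lexMin (a ∷ as) with lexMin as
... | nothing = just a
... | just b  = if isLt (lexℕ b a) then just b else just a

nextPart : ℕ → List ℕ → Maybe (List ℕ)
nextPart p a = lexMin (filter (λ b → Data.Bool._≟_ (isLt (lexℕ a b)) true) (allParts p))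

exhausted : Tree → Bool
exhausted leaf = true
exhausted v    = eqList (induced v) (maxPart (leaves v))

flat : ℕ → Tree
flat k = node (replicate k leaf)

part→child : ℕ → Tree
part→child b = if b ≡ᵇ 1 then leaf else flat b

fixSibling : Tree → Tree → Tree
fixSibling x y = if leaves y ≡ᵇ leaves x then x else flat (leaves y)

-- next t: the result of NextTree restricted to the subtree t,
-- i.e. `nothing` if T(t) contains no non-exhausted node, otherwise
-- the subtree after steps (ii) and (iii) below t.
-- nextL cs processes a children list in inverted order (last child first).
mutual
  next : Tree → Maybe Tree
  next leaf = nothing
  next (node cs) with nextL cs
  ... | just cs' = just (node cs')
  ... | nothing  = if exhausted (node cs) then nothing
                   else newSub (nextPart (leaves (node cs)) (induced (node cs)))
    where
    newSub : Maybe (List ℕ) → Maybe Tree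
    newSub nothing  = nothing
    newSub (just b) = just (node (map part→child b))

  nextL : List Tree → Maybe (List Tree)
  nextL [] = nothing
  nextL (c ∷ cs) with nextL cs
  ... | just cs' = just (c ∷ cs')
  ... | nothing with next c
  ...   | nothing = nothing
  ...   | just c' = just (c' ∷ map (fixSibling c') cs)

NextTree : Tree → Maybe Tree
NextTree = next

-- NextTree replaces the subtree at the pivot v, and then every subtree arranged
-- after v or after one of its ancestors, by a tree with the same number of leaves
-- that is strictly larger in the node order: v receives the next partition of its
-- leaf count, a later sibling of equal size becomes a copy of the enlarged subtree,
-- and a larger sibling becomes flat (hence still comes after, having more leaves).
-- The node order compares children lists lexicographically, so every children list
-- stays non-decreasing and the result is ordered; this needs transitivity of the
-- order, proved for the fuelled comparison cmpF at each fixed fuel, together with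
-- the fact that cmpF no longer depends on the fuel once it exceeds the sizes of
-- the two trees. If there is no pivot, every node induces the maximal partition of
-- its leaf count, and such a tree lies above every tree of 𝕋ₙ: first the partitions
-- at the root are compared, and if they agree the children are compared pairwise.

module Submission where

open import Defs
open import Data.Nat
  using (ℕ; zero; suc; _+_; _*_; _∸_; _≤_; _<_; _≤?_; _<ᵇ_; _≡ᵇ_; _/_; z≤n; s≤s)
open import Data.Nat.DivMod using (m*n/n≡m; /-monoˡ-≤; m/n*n≤m)
open import Data.Nat.Properties
open import Data.Bool using (true; false; T; if_then_else_)
import Data.Bool as Bool
open import Data.List using (List; []; _∷_; map; length; filter; upTo; replicate)
open import Data.List.Properties
  using (length-map; length-replicate; map-∘; map-cong; ∷-injectiveˡ; ∷-injectiveʳ)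
open import Data.List.Relation.Unary.All using (All; []; _∷_)
import Data.List.Relation.Unary.All as All
import Data.List.Relation.Unary.All.Properties as All
open import Data.List.Relation.Unary.AllPairs using (AllPairs; []; _∷_)
import Data.List.Relation.Unary.AllPairs as AllPairs
open import Data.List.Relation.Unary.Linked using (Linked; []; [-]; _∷_)
import Data.List.Relation.Unary.Linked as Linked
import Data.List.Relation.Unary.Linked.Properties as Linked
open import Data.List.Relation.Binary.Permutation.Propositional
  using (_↭_; ↭-refl; ↭-prep; ↭-swap; ↭-trans; ↭-sym)
open import Data.List.Relation.Binary.Permutation.Propositional.Properties
  using (All-resp-↭; map⁺; ↭-length)
open import Data.Nat.ListAction using (sum)
open import Data.Nat.ListAction.Properties using (sum-↭)
open import Data.List.Membership.Propositional using (_∈_; find; lose)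
open import Data.List.Membership.Propositional.Properties
  using (∈-concatMap⁺; ∈-concatMap⁻; ∈-filter⁺; ∈-filter⁻; ∈-map⁺; ∈-map⁻; ∈-upTo⁺; ∈-upTo⁻)
open import Data.List.Relation.Unary.Any using (here; there)
open import Data.Maybe using (just; nothing)
open import Data.Product using (Σ; ∃; _×_; _,_; proj₁; proj₂)
open import Data.Sum using (_⊎_; inj₁; inj₂)
open import Data.Empty using (⊥-elim)
open import Function using (_on_)
open import Data.Unit using (⊤; tt)
open import Relation.Binary.PropositionalEquality
open import Relation.Nullary using (¬_; yes; no)

lexStep : Cmp → Cmp → Cmp
lexStep lt _ = lt
lexStep eq r = r
lexStep gt _ = gt

-- TransCmp a b c: the outcomes c of comparing x with z that transitivity
-- allows once x against y gave a and y against z gave b.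
TransCmp : Cmp → Cmp → Cmp → Set
TransCmp lt lt c = c ≡ lt
TransCmp lt eq c = c ≡ lt
TransCmp lt gt c = ⊤
TransCmp eq b  c = c ≡ b
TransCmp gt lt c = ⊤
TransCmp gt eq c = c ≡ gt
TransCmp gt gt c = c ≡ gt

CmpTransitive : {A : Set} → (A → A → Cmp) → Set
CmpTransitive {A} cmp = ∀ x y z → TransCmp (cmp x y) (cmp y z) (cmp x z)

transCmp-ltˡ : ∀ b → TransCmp lt b lt
transCmp-ltˡ lt = refl
transCmp-ltˡ eq = refl
transCmp-ltˡ gt = tt

transCmp-gtˡ : ∀ b → TransCmp gt b gt
transCmp-gtˡ lt = tt
transCmp-gtˡ eq = refl
transCmp-gtˡ gt = refl

transCmp-ltʳ : ∀ a → TransCmp a lt lt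
transCmp-ltʳ lt = refl
transCmp-ltʳ eq = refl
transCmp-ltʳ gt = tt

transCmp-gtʳ : ∀ a → TransCmp a gt gt
transCmp-gtʳ lt = tt
transCmp-gtʳ eq = refl
transCmp-gtʳ gt = refl

transCmp-≢gt : ∀ {a b c} → TransCmp a b c → a ≢ gt → b ≢ gt → c ≢ gt
transCmp-≢gt {lt} {lt} refl _ _ ()
transCmp-≢gt {lt} {eq} refl _ _ ()
transCmp-≢gt {lt} {gt} _ _ b≢gt = ⊥-elim (b≢gt refl)
transCmp-≢gt {eq} refl _ b≢gt = b≢gt
transCmp-≢gt {gt} _ a≢gt _ = ⊥-elim (a≢gt refl)

lexStep-trans : ∀ a b c r s t → TransCmp a b c → (a ≡ eq → b ≡ eq → TransCmp r s t) →
                TransCmp (lexStep a r) (lexStep b s) (lexStep c t)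
lexStep-trans lt lt .lt r s t refl _ = refl
lexStep-trans lt eq .lt r s t refl _ = transCmp-ltˡ s
lexStep-trans lt gt c   r s t _    _ = tt
lexStep-trans eq lt .lt r s t refl _ = transCmp-ltʳ r
lexStep-trans eq eq .eq r s t refl h = h refl refl
lexStep-trans eq gt .gt r s t refl _ = transCmp-gtʳ r
lexStep-trans gt lt c   r s t _    _ = tt
lexStep-trans gt eq .gt r s t refl _ = transCmp-gtˡ s
lexStep-trans gt gt .gt r s t refl _ = refl

lexStep-≢gt : ∀ {a b} → a ≢ gt → b ≢ gt → lexStep a b ≢ gt
lexStep-≢gt {lt} _ _ ()
lexStep-≢gt {eq} _ b≢gt = b≢gt
lexStep-≢gt {gt} a≢gt _ = ⊥-elim (a≢gt refl)

lt≢gt : lt ≢ gt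
lt≢gt ()

eq≢gt : eq ≢ gt
eq≢gt ()

module _ {A : Set} (cmp : A → A → Cmp) where

  lexBy-∷ : ∀ x xs y ys → lexBy cmp (x ∷ xs) (y ∷ ys) ≡ lexStep (cmp x y) (lexBy cmp xs ys)
  lexBy-∷ x xs y ys with cmp x y
  ... | lt = refl
  ... | eq = refl
  ... | gt = refl

  lexBy-trans : CmpTransitive cmp → CmpTransitive (lexBy cmp)
  lexBy-trans t [] [] [] = refl
  lexBy-trans t [] [] (z ∷ zs) = refl
  lexBy-trans t [] (y ∷ ys) [] = tt
  lexBy-trans t [] (y ∷ ys) (z ∷ zs) = transCmp-ltˡ (lexBy cmp (y ∷ ys) (z ∷ zs))
  lexBy-trans t (x ∷ xs) [] [] = refl
  lexBy-trans t (x ∷ xs) [] (z ∷ zs) = tt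
  lexBy-trans t (x ∷ xs) (y ∷ ys) [] = transCmp-gtʳ (lexBy cmp (x ∷ xs) (y ∷ ys))
  lexBy-trans t (x ∷ xs) (y ∷ ys) (z ∷ zs)
    rewrite lexBy-∷ x xs y ys | lexBy-∷ y ys z zs | lexBy-∷ x xs z zs =
    lexStep-trans _ _ _ _ _ _ (t x y z) (λ _ _ → lexBy-trans t xs ys zs)

  lexBy-refl : (∀ x → cmp x x ≡ eq) → ∀ xs → lexBy cmp xs xs ≡ eq
  lexBy-refl r [] = refl
  lexBy-refl r (x ∷ xs) rewrite lexBy-∷ x xs x xs | r x = lexBy-refl r xs

  lexBy-eq⇒≡ : (∀ x y → cmp x y ≡ eq → x ≡ y) → ∀ xs ys → lexBy cmp xs ys ≡ eq → xs ≡ ys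
  lexBy-eq⇒≡ h [] [] _ = refl
  lexBy-eq⇒≡ h (x ∷ xs) (y ∷ ys) e rewrite lexBy-∷ x xs y ys with cmp x y in cmp≡
  ... | eq = cong₂ _∷_ (h x y cmp≡) (lexBy-eq⇒≡ h xs ys e)

  lexBy-lt⇒head≢gt : ∀ {x xs y ys} → lexBy cmp (x ∷ xs) (y ∷ ys) ≡ lt → cmp x y ≢ gt
  lexBy-lt⇒head≢gt {x} {xs} {y} {ys} e cmp≡gt
    rewrite lexBy-∷ x xs y ys | cmp≡gt = lt≢gt (sym e)

lexBy-cong : ∀ {A : Set} {P Q : A → Set} (cmp cmp′ : A → A → Cmp) →
             (∀ {x y} → P x → Q y → cmp x y ≡ cmp′ x y) →
             ∀ {xs ys} → All P xs → All Q ys → lexBy cmp xs ys ≡ lexBy cmp′ xs ys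
lexBy-cong cmp cmp′ f [] [] = refl
lexBy-cong cmp cmp′ f [] (_ ∷ _) = refl
lexBy-cong cmp cmp′ f (_ ∷ _) [] = refl
lexBy-cong cmp cmp′ f {x ∷ xs} {y ∷ ys} (px ∷ pxs) (qy ∷ qys)
  rewrite lexBy-∷ cmp x xs y ys | lexBy-∷ cmp′ x xs y ys | f px qy
        | lexBy-cong cmp cmp′ f pxs qys = refl

data CmpℕView (m n : ℕ) : Cmp → Set where
  vlt : m < n → CmpℕView m n lt
  veq : m ≡ n → CmpℕView m n eq
  vgt : n < m → CmpℕView m n gt

cmpℕ-view : ∀ m n → CmpℕView m n (cmpℕ m n)
cmpℕ-view m n with m <ᵇ n in m<ᵇn
... | true = vlt (<ᵇ⇒< m n (subst T (sym m<ᵇn) tt))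
... | false with n <ᵇ m in n<ᵇm
...   | true  = vgt (<ᵇ⇒< n m (subst T (sym n<ᵇm) tt))
...   | false = veq (≤-antisym (≮⇒≥ (λ n<m → subst T n<ᵇm (<⇒<ᵇ n<m)))
                               (≮⇒≥ (λ m<n → subst T m<ᵇn (<⇒<ᵇ m<n))))

cmpℕ-< : ∀ {m n} → m < n → cmpℕ m n ≡ lt
cmpℕ-< {m} {n} m<n with cmpℕ m n | cmpℕ-view m n
... | lt | _ = refl
... | eq | veq refl = ⊥-elim (n≮n m m<n)
... | gt | vgt n<m = ⊥-elim (<-asym m<n n<m)

cmpℕ-> : ∀ {m n} → n < m → cmpℕ m n ≡ gt
cmpℕ-> {m} {n} n<m with cmpℕ m n | cmpℕ-view m n
... | lt | vlt m<n = ⊥-elim (<-asym m<n n<m)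
... | eq | veq refl = ⊥-elim (n≮n m n<m)
... | gt | _ = refl

cmpℕ-refl : ∀ m → cmpℕ m m ≡ eq
cmpℕ-refl m with cmpℕ m m | cmpℕ-view m m
... | lt | vlt m<m = ⊥-elim (n≮n m m<m)
... | eq | _ = refl
... | gt | vgt m<m = ⊥-elim (n≮n m m<m)

cmpℕ-eq⇒≡ : ∀ m n → cmpℕ m n ≡ eq → m ≡ n
cmpℕ-eq⇒≡ m n e with cmpℕ m n | cmpℕ-view m n
cmpℕ-eq⇒≡ m n refl | eq | veq m≡n = m≡n

cmpℕ-≢gt⇒≤ : ∀ {m n} → cmpℕ m n ≢ gt → m ≤ n
cmpℕ-≢gt⇒≤ {m} {n} h with cmpℕ m n | cmpℕ-view m n
... | lt | vlt m<n = <⇒≤ m<n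
... | eq | veq m≡n = ≤-reflexive m≡n
... | gt | _ = ⊥-elim (h refl)

cmpℕ-gt⇒≥ : ∀ {m n} → cmpℕ m n ≡ gt → n ≤ m
cmpℕ-gt⇒≥ {m} {n} h with cmpℕ m n | cmpℕ-view m n
cmpℕ-gt⇒≥ refl | gt | vgt n<m = <⇒≤ n<m

cmpℕ-trans : CmpTransitive cmpℕ
cmpℕ-trans x y z with cmpℕ x y | cmpℕ-view x y
... | eq | veq refl = refl
... | lt | vlt x<y with cmpℕ y z | cmpℕ-view y z
...   | lt | vlt y<z  = cmpℕ-< (<-trans x<y y<z)
...   | eq | veq refl = cmpℕ-< x<y
...   | gt | _        = tt
cmpℕ-trans x y z | gt | vgt y<x with cmpℕ y z | cmpℕ-view y z
...   | lt | _        = tt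
...   | eq | veq refl = cmpℕ-> y<x
...   | gt | vgt z<y  = cmpℕ-> (<-trans z<y y<x)

lexℕ-trans : CmpTransitive lexℕ
lexℕ-trans = lexBy-trans cmpℕ cmpℕ-trans

lexℕ-refl : ∀ xs → lexℕ xs xs ≡ eq
lexℕ-refl = lexBy-refl cmpℕ cmpℕ-refl

lexℕ-eq⇒≡ : ∀ xs ys → lexℕ xs ys ≡ eq → xs ≡ ys
lexℕ-eq⇒≡ = lexBy-eq⇒≡ cmpℕ cmpℕ-eq⇒≡

module _ {A : Set} (cmp : A → A → Cmp) where

  insertBy-↭ : ∀ x ys → insertBy cmp x ys ↭ x ∷ ys
  insertBy-↭ x [] = ↭-refl
  insertBy-↭ x (y ∷ ys) with cmp x y
  ... | lt = ↭-refl
  ... | eq = ↭-refl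
  ... | gt = ↭-trans (↭-prep y (insertBy-↭ x ys)) (↭-swap y x ↭-refl)

  sortBy-↭ : ∀ xs → sortBy cmp xs ↭ xs
  sortBy-↭ [] = ↭-refl
  sortBy-↭ (x ∷ xs) = ↭-trans (insertBy-↭ x (sortBy cmp xs)) (↭-prep x (sortBy-↭ xs))

  sortBy-id : ∀ {xs} → Linked (λ x y → cmp x y ≢ gt) xs → sortBy cmp xs ≡ xs
  sortBy-id {[]} _ = refl
  sortBy-id {x ∷ []} _ = refl
  sortBy-id {x ∷ y ∷ ys} (x≤y ∷ sorted) rewrite sortBy-id sorted with cmp x y in cmp≡
  ... | lt = refl
  ... | eq = refl
  ... | gt = ⊥-elim (x≤y refl)

  module _ (R : A → A → Set) (gt⇒R : ∀ {x y} → cmp x y ≡ gt → R y x)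
           (≢gt⇒R : ∀ {x y} → cmp x y ≢ gt → R x y) where

    insertBy-Linked : ∀ x ys → Linked R ys → Linked R (insertBy cmp x ys)
    insertBy-Linked x [] _ = [-]
    insertBy-Linked x (y ∷ ys) sorted with cmp x y in cmp≡
    ... | lt = ≢gt⇒R (λ e → lt≢gt (trans (sym cmp≡) e)) ∷ sorted
    ... | eq = ≢gt⇒R (λ e → eq≢gt (trans (sym cmp≡) e)) ∷ sorted
    ... | gt = insert-after y ys (gt⇒R cmp≡) sorted
      where
      insert-after : ∀ y ys → R y x → Linked R (y ∷ ys) → Linked R (y ∷ insertBy cmp x ys)
      insert-after y [] y≤x _ = y≤x ∷ [-]
      insert-after y (z ∷ zs) y≤x (y≤z ∷ sorted) with cmp x z in cmp≡
      ... | lt = y≤x ∷ ≢gt⇒R (λ e → lt≢gt (trans (sym cmp≡) e)) ∷ sorted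
      ... | eq = y≤x ∷ ≢gt⇒R (λ e → eq≢gt (trans (sym cmp≡) e)) ∷ sorted
      ... | gt = y≤z ∷ insert-after z zs (gt⇒R cmp≡) sorted

    sortBy-Linked : ∀ xs → Linked R (sortBy cmp xs)
    sortBy-Linked [] = []
    sortBy-Linked (x ∷ xs) = insertBy-Linked x (sortBy cmp xs) (sortBy-Linked xs)

sortBy-cong : ∀ {A : Set} (cmp cmp′ : A → A → Cmp) xs →
              AllPairs (λ x y → cmp x y ≡ cmp′ x y) xs → sortBy cmp xs ≡ sortBy cmp′ xs
sortBy-cong cmp cmp′ [] [] = refl
sortBy-cong cmp cmp′ (x ∷ xs) (x-agrees ∷ agree) rewrite sortBy-cong cmp cmp′ xs agree =
  insertBy-cong (sortBy cmp′ xs) (All-resp-↭ (↭-sym (sortBy-↭ cmp′ xs)) x-agrees)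
  where
  insertBy-cong : ∀ ys → All (λ y → cmp x y ≡ cmp′ x y) ys → insertBy cmp x ys ≡ insertBy cmp′ x ys
  insertBy-cong [] [] = refl
  insertBy-cong (y ∷ ys) (e ∷ es) with cmp x y | cmp′ x y | e
  ... | lt | .lt | refl = refl
  ... | eq | .eq | refl = refl
  ... | gt | .gt | refl = cong (y ∷_) (insertBy-cong ys es)

Linked-replace-head : ∀ {A : Set} {R : A → A → Set} {x x′ xs} → (∀ {z} → R x z → R x′ z) →
                      Linked R (x ∷ xs) → Linked R (x′ ∷ xs)
Linked-replace-head f [-] = [-]
Linked-replace-head f (r ∷ rs) = f r ∷ rs

leavesL≡sum : ∀ cs → leavesL cs ≡ sum (map leaves cs)
leavesL≡sum [] = refl
leavesL≡sum (c ∷ cs) = cong (leaves c +_) (leavesL≡sum cs)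

leavesL-↭ : ∀ {cs ds} → cs ↭ ds → leavesL cs ≡ leavesL ds
leavesL-↭ {cs} {ds} p = begin
  leavesL cs            ≡⟨ leavesL≡sum cs ⟩
  sum (map leaves cs)   ≡⟨ sum-↭ (map⁺ leaves p) ⟩
  sum (map leaves ds)   ≡⟨ leavesL≡sum ds ⟨
  leavesL ds            ∎
  where open ≡-Reasoning

2≤⇒≢1 : ∀ {n} → 2 ≤ n → n ≢ 1
2≤⇒≢1 (s≤s ()) refl

mutual
  InT⇒leaves≥1 : ∀ {t} → InT t → 1 ≤ leaves t
  InT⇒leaves≥1 leafT = s≤s z≤n
  InT⇒leaves≥1 (nodeT two≤len ins) = ≤-trans (s≤s z≤n) (node-leaves≥2 two≤len ins)

  node-leaves≥2 : ∀ {cs} → 2 ≤ length cs → All InT cs → 2 ≤ leavesL cs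
  node-leaves≥2 two≤len ins = ≤-trans two≤len (length≤leavesL ins)

  length≤leavesL : ∀ {cs} → All InT cs → length cs ≤ leavesL cs
  length≤leavesL [] = z≤n
  length≤leavesL (i ∷ ins) = +-mono-≤ (InT⇒leaves≥1 i) (length≤leavesL ins)

InT-children : ∀ {cs} → InT (node cs) → All InT cs
InT-children (nodeT _ ins) = ins

mutual
  Ordered⇒InT : ∀ {t} → Ordered t → InT t
  Ordered⇒InT leafO = leafT
  Ordered⇒InT (nodeO two≤len os _) = nodeT two≤len (All-Ordered⇒InT os)

  All-Ordered⇒InT : ∀ {cs} → All Ordered cs → All InT cs
  All-Ordered⇒InT [] = []
  All-Ordered⇒InT (o ∷ os) = Ordered⇒InT o ∷ All-Ordered⇒InT os

size≤sizeL : ∀ xs {b} → sizeL xs ≤ b → All (λ x → size x ≤ b) xs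
size≤sizeL [] _ = []
size≤sizeL (x ∷ xs) h = ≤-trans (m≤m+n _ _) h ∷ size≤sizeL xs (≤-trans (m≤n+m _ _) h)

size+size≤sizeL : ∀ xs {b} → sizeL xs ≤ b → AllPairs (λ x y → size x + size y ≤ b) xs
size+size≤sizeL [] _ = []
size+size≤sizeL (x ∷ xs) h =
  All.map (λ y≤ → ≤-trans (+-monoʳ-≤ (size x) y≤) h) (size≤sizeL xs ≤-refl)
  ∷ size+size≤sizeL xs (≤-trans (m≤n+m _ _) h)

sortF : ℕ → List Tree → List Tree
sortF k = sortBy (cmpF k)

cmpTie : ℕ → Tree → Tree → Cmp
cmpTie k leaf w = eq
cmpTie k (node cs) leaf = eq
cmpTie zero (node cs) (node ds) = eq
cmpTie (suc k) (node cs) (node ds) =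
  if leaves (node cs) ≡ᵇ 1 then eq else
  lexStep (lexℕ (map leaves (sortF k cs)) (map leaves (sortF k ds)))
          (lexBy (cmpF k) (sortF k cs) (sortF k ds))

cmpF-unfold : ∀ k v w → cmpF k v w ≡ lexStep (cmpℕ (leaves v) (leaves w)) (cmpTie k v w)
cmpF-unfold k v w with cmpℕ (leaves v) (leaves w)
cmpF-unfold k v w | lt = refl
cmpF-unfold k v w | gt = refl
cmpF-unfold k leaf w | eq = refl
cmpF-unfold k (node cs) leaf | eq = refl
cmpF-unfold zero (node cs) (node ds) | eq = refl
cmpF-unfold (suc k) (node cs) (node ds) | eq with leavesL cs ≡ᵇ 1
... | true = refl
... | false with lexℕ (map leaves (sortF k cs)) (map leaves (sortF k ds))
...   | lt = refl
...   | eq = refl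
...   | gt = refl

cmpTie-one : ∀ k v w → leaves v ≡ 1 → cmpTie k v w ≡ eq
cmpTie-one k leaf w _ = refl
cmpTie-one k (node cs) leaf _ = refl
cmpTie-one zero (node cs) (node ds) _ = refl
cmpTie-one (suc k) (node cs) (node ds) one rewrite one = refl

cmpTie-node : ∀ k cs ds → leavesL cs ≢ 1 →
  cmpTie (suc k) (node cs) (node ds) ≡
  lexStep (lexℕ (map leaves (sortF k cs)) (map leaves (sortF k ds)))
          (lexBy (cmpF k) (sortF k cs) (sortF k ds))
cmpTie-node k cs ds not-one with leavesL cs ≡ᵇ 1 in e
... | true = ⊥-elim (not-one (≡ᵇ⇒≡ _ 1 (subst T (sym e) tt)))
... | false = refl

cmpF-tie : ∀ k v w → leaves v ≡ leaves w → cmpF k v w ≡ cmpTie k v w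
cmpF-tie k v w same rewrite cmpF-unfold k v w | same | cmpℕ-refl (leaves w) = refl

cmpF-< : ∀ k v w → leaves v < leaves w → cmpF k v w ≡ lt
cmpF-< k v w fewer rewrite cmpF-unfold k v w | cmpℕ-< fewer = refl

cmpF-≢gt⇒leaves≤ : ∀ k v w → cmpF k v w ≢ gt → leaves v ≤ leaves w
cmpF-≢gt⇒leaves≤ k v w h rewrite cmpF-unfold k v w =
  cmpℕ-≢gt⇒≤ (λ e → h (cong (λ c → lexStep c (cmpTie k v w)) e))

cmpF-gt⇒leaves≥ : ∀ k v w → cmpF k v w ≡ gt → leaves w ≤ leaves v
cmpF-gt⇒leaves≥ k v w h rewrite cmpF-unfold k v w with cmpℕ (leaves v) (leaves w) in e
... | eq = ≤-reflexive (sym (cmpℕ-eq⇒≡ _ _ e))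
... | gt = cmpℕ-gt⇒≥ e

cmpF-refl : ∀ k v → cmpF k v v ≡ eq
cmpF-refl k v rewrite cmpF-tie k v v refl = tie k v
  where
  tie : ∀ k v → cmpTie k v v ≡ eq
  tie k leaf = refl
  tie zero (node cs) = refl
  tie (suc k) (node cs) with leavesL cs ≡ᵇ 1
  ... | true = refl
  ... | false rewrite lexℕ-refl (map leaves (sortF k cs)) =
    lexBy-refl (cmpF k) (cmpF-refl k) (sortF k cs)

cmpF-trans : ∀ k → CmpTransitive (cmpF k)
cmpF-trans k u v w rewrite cmpF-unfold k u v | cmpF-unfold k v w | cmpF-unfold k u w =
  lexStep-trans _ _ _ _ _ _ (cmpℕ-trans (leaves u) (leaves v) (leaves w))
    (λ e₁ e₂ → tie-trans k u v w (cmpℕ-eq⇒≡ _ _ e₁) (cmpℕ-eq⇒≡ _ _ e₂))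
  where
  tie-trans : ∀ k u v w → leaves u ≡ leaves v → leaves v ≡ leaves w →
              TransCmp (cmpTie k u v) (cmpTie k v w) (cmpTie k u w)
  tie-trans k u v w e₁ e₂ with leaves u ≟ 1
  ... | yes one rewrite cmpTie-one k u v one | cmpTie-one k v w (trans (sym e₁) one)
                      | cmpTie-one k u w one = refl
  tie-trans k leaf v w e₁ e₂ | no not-one = ⊥-elim (not-one refl)
  tie-trans k (node cs) leaf w e₁ e₂ | no not-one = ⊥-elim (not-one e₁)
  tie-trans k (node cs) (node ds) leaf e₁ e₂ | no not-one = ⊥-elim (not-one (trans e₁ e₂))
  tie-trans zero (node cs) (node ds) (node es) e₁ e₂ | no not-one = refl
  tie-trans (suc k) (node cs) (node ds) (node es) e₁ e₂ | no not-one
    rewrite cmpTie-node k cs ds not-one | cmpTie-node k ds es (λ one → not-one (trans e₁ one))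
          | cmpTie-node k cs es not-one =
    lexStep-trans _ _ _ _ _ _
      (lexℕ-trans (map leaves (sortF k cs)) (map leaves (sortF k ds)) (map leaves (sortF k es)))
      (λ _ _ → lexBy-trans (cmpF k) (cmpF-trans k) (sortF k cs) (sortF k ds) (sortF k es))

mutual
  cmpF-fuel : ∀ {k k′} v w → size v + size w ≤ k → size v + size w ≤ k′ →
              cmpF k v w ≡ cmpF k′ v w
  cmpF-fuel {k} {k′} v w h h′
    rewrite cmpF-unfold k v w | cmpF-unfold k′ v w | cmpTie-fuel v w h h′ = refl

  cmpTie-fuel : ∀ {k k′} v w → size v + size w ≤ k → size v + size w ≤ k′ →
                cmpTie k v w ≡ cmpTie k′ v w
  cmpTie-fuel leaf w _ _ = refl
  cmpTie-fuel (node cs) leaf _ _ = refl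
  cmpTie-fuel {suc j} {suc j′} (node cs) (node ds) (s≤s h) (s≤s h′) =
    cong (if leavesL cs ≡ᵇ 1 then eq else_)
      (cong₂ lexStep (cong₂ lexℕ (cong (map leaves) sort-cs) (cong (map leaves) sort-ds))
                     (trans (cong₂ (lexBy (cmpF j)) sort-cs sort-ds)
                            (lexBy-cong (cmpF j) (cmpF j′)
                               (λ {x} {y} x≤ y≤ → cmpF-fuel x y (across h x≤ y≤) (across h′ x≤ y≤))
                               (children-small cs) (children-small ds))))
    where
    sort-cs : sortF j cs ≡ sortF j′ cs
    sort-cs = sortF-fuel cs (≤-trans (m≤m+n _ _) h) (≤-trans (m≤m+n _ _) h′)
    sort-ds : sortF j ds ≡ sortF j′ ds
    sort-ds = sortF-fuel ds (≤-trans (≤-trans (n≤1+n _) (m≤n+m _ _)) h)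
                            (≤-trans (≤-trans (n≤1+n _) (m≤n+m _ _)) h′)
    across : ∀ {b x y} → sizeL cs + suc (sizeL ds) ≤ b → size x ≤ sizeL cs → size y ≤ sizeL ds →
             size x + size y ≤ b
    across h x≤ y≤ = ≤-trans (+-mono-≤ x≤ (≤-trans y≤ (n≤1+n _))) h
    children-small : ∀ xs → All (λ x → size x ≤ sizeL xs) (sortF j′ xs)
    children-small xs = All-resp-↭ (↭-sym (sortBy-↭ (cmpF j′) xs)) (size≤sizeL xs ≤-refl)

  sortF-fuel : ∀ {k k′} xs → sizeL xs ≤ k → sizeL xs ≤ k′ → sortF k xs ≡ sortF k′ xs
  sortF-fuel xs h h′ = sortBy-cong _ _ xs
    (AllPairs.map (λ {x} {y} small → cmpF-fuel x y (≤-trans small h) (≤-trans small h′))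
                  (size+size≤sizeL xs ≤-refl))

cmpT≡cmpF : ∀ {k} v w → size v + size w ≤ k → cmpT v w ≡ cmpF k v w
cmpT≡cmpF v w h = cmpF-fuel v w ≤-refl h

cmpT-refl : ∀ v → cmpT v v ≡ eq
cmpT-refl v = cmpF-refl _ v

cmpT-trans : CmpTransitive cmpT
cmpT-trans u v w =
  transport (cmpT≡cmpF u v (≤-trans (m≤m+n _ _) (m≤m+n _ _)))
            (cmpT≡cmpF v w (≤-trans (m≤n+m _ (size u + size v)) (m≤m+n _ _)))
            (cmpT≡cmpF u w (m≤n+m (size u + size w) ((size u + size v) + (size v + size w))))
            (cmpF-trans ((size u + size v) + (size v + size w) + (size u + size w)) u v w)
  where
  transport : ∀ {a b c a′ b′ c′} → a ≡ a′ → b ≡ b′ → c ≡ c′ → TransCmp a′ b′ c′ → TransCmp a b c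
  transport refl refl refl t = t

≤T-refl : ∀ v → v ≤T v
≤T-refl v e = eq≢gt (trans (sym (cmpT-refl v)) e)

≤T-trans : ∀ {u v w} → u ≤T v → v ≤T w → u ≤T w
≤T-trans {u} {v} {w} = transCmp-≢gt (cmpT-trans u v w)

<T⇒≤T : ∀ {v w} → cmpT v w ≡ lt → v ≤T w
<T⇒≤T e e′ = lt≢gt (trans (sym e) e′)

cmpT-< : ∀ {v w} → leaves v < leaves w → cmpT v w ≡ lt
cmpT-< {v} {w} = cmpF-< _ v w

≤T⇒leaves≤ : ∀ {v w} → v ≤T w → leaves v ≤ leaves w
≤T⇒leaves≤ {v} {w} = cmpF-≢gt⇒leaves≤ _ v w

induced-nondecreasing : ∀ cs → Linked _≤_ (induced (node cs))
induced-nondecreasing cs =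
  Linked.map⁺ (sortBy-Linked cmpT (λ v w → leaves v ≤ leaves w)
                 (λ {v} {w} → cmpF-gt⇒leaves≥ _ v w) (λ {v} {w} → cmpF-≢gt⇒leaves≤ _ v w) cs)

sortedChildren-ordered : ∀ {cs} → Linked _≤T_ cs → sortedChildren cs ≡ cs
sortedChildren-ordered = sortBy-id cmpT

induced-ordered : ∀ {cs} → Linked _≤T_ cs → induced (node cs) ≡ map leaves cs
induced-ordered sorted = cong (map leaves) (sortedChildren-ordered sorted)

sortF≡sortedChildren : ∀ {k} xs → sizeL xs ≤ k → sortF k xs ≡ sortedChildren xs
sortF≡sortedChildren xs h = sortBy-cong _ _ xs
  (AllPairs.map (λ {x} {y} small → sym (cmpT≡cmpF x y (≤-trans small h)))
                (size+size≤sizeL xs ≤-refl))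

cmpT-node : ∀ cs ds → leavesL cs ≡ leavesL ds → leavesL cs ≢ 1 →
  cmpT (node cs) (node ds) ≡
  lexStep (lexℕ (induced (node cs)) (induced (node ds)))
          (lexBy cmpT (sortedChildren cs) (sortedChildren ds))
cmpT-node cs ds same not-one = begin
  cmpF (suc j) (node cs) (node ds)
    ≡⟨ cmpF-tie (suc j) (node cs) (node ds) same ⟩
  cmpTie (suc j) (node cs) (node ds)
    ≡⟨ cmpTie-node j cs ds not-one ⟩
  lexStep (lexℕ (map leaves (sortF j cs)) (map leaves (sortF j ds)))
          (lexBy (cmpF j) (sortF j cs) (sortF j ds))
    ≡⟨ cong₂ (λ cs′ ds′ → lexStep (lexℕ (map leaves cs′) (map leaves ds′)) (lexBy (cmpF j) cs′ ds′))
             (sortF≡sortedChildren cs (m≤m+n _ _))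
             (sortF≡sortedChildren ds (≤-trans (n≤1+n _) (m≤n+m _ _))) ⟩
  lexStep (lexℕ (induced (node cs)) (induced (node ds)))
          (lexBy (cmpF j) (sortedChildren cs) (sortedChildren ds))
    ≡⟨ cong (lexStep _) (lexBy-cong (cmpF j) cmpT
            (λ {x} {y} x≤ y≤ → sym (cmpT≡cmpF x y (+-mono-≤ x≤ (≤-trans y≤ (n≤1+n _)))))
            (children-small cs) (children-small ds)) ⟩
  lexStep (lexℕ (induced (node cs)) (induced (node ds)))
          (lexBy cmpT (sortedChildren cs) (sortedChildren ds)) ∎
  where
  open ≡-Reasoning
  j = sizeL cs + suc (sizeL ds)
  children-small : ∀ xs → All (λ x → size x ≤ sizeL xs) (sortedChildren xs)
  children-small xs = All-resp-↭ (↭-sym (sortBy-↭ cmpT xs)) (size≤sizeL xs ≤-refl)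

cmpT-ordered-nodes : ∀ {cs ds} → Linked _≤T_ cs → Linked _≤T_ ds →
  leavesL cs ≡ leavesL ds → leavesL cs ≢ 1 →
  cmpT (node cs) (node ds) ≡ lexStep (lexℕ (map leaves cs) (map leaves ds)) (lexBy cmpT cs ds)
cmpT-ordered-nodes {cs} {ds} cs-sorted ds-sorted same not-one
  rewrite cmpT-node cs ds same not-one | sortedChildren-ordered cs-sorted
        | sortedChildren-ordered ds-sorted = refl

record IsPart (p : ℕ) (a : List ℕ) : Set where
  field
    nondecreasing : Linked _≤_ a
    positive      : All (1 ≤_) a
    two≤length    : 2 ≤ length a
    sum≡          : sum a ≡ p

m+m≤n⇒m≤n/2 : ∀ {p a} → a + a ≤ p → a ≤ p / 2
m+m≤n⇒m≤n/2 {p} {a} a+a≤p =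
  subst (_≤ p / 2) (m*n/n≡m a 2) (/-monoˡ-≤ 2 (subst (_≤ p) a+a≡a*2 a+a≤p))
  where
  a+a≡a*2 : a + a ≡ a * 2
  a+a≡a*2 = trans (cong (a +_) (sym (+-identityʳ a))) (*-comm 2 a)

n/2+n/2≤n : ∀ p → p / 2 + p / 2 ≤ p
n/2+n/2≤n p = subst (_≤ p) (trans (*-comm (p / 2) 2) (cong (p / 2 +_) (+-identityʳ _))) (m/n*n≤m p 2)

sum≡0⇒[] : ∀ {xs} → All (1 ≤_) xs → sum xs ≡ 0 → xs ≡ []
sum≡0⇒[] [] _ = refl
sum≡0⇒[] (s≤s _ ∷ _) ()

first-two≤sum : ∀ a₁ a₂ rest {p} → sum (a₁ ∷ a₂ ∷ rest) ≡ p → a₁ + a₂ ≤ p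
first-two≤sum a₁ a₂ rest sum≡p =
  ≤-trans (m≤m+n (a₁ + a₂) (sum rest)) (≤-reflexive (trans (+-assoc a₁ a₂ (sum rest)) sum≡p))

maxPart-greatest : ∀ {p a} → IsPart p a → lexℕ a (maxPart p) ≡ lt ⊎ a ≡ maxPart p
maxPart-greatest {p} {a₁ ∷ a₂ ∷ rest}
    record { nondecreasing = a₁≤a₂ ∷ _ ; positive = _ ∷ _ ∷ rest-pos ; sum≡ = sum≡p }
  rewrite lexBy-∷ cmpℕ a₁ (a₂ ∷ rest) (p / 2) (p ∸ p / 2 ∷ [])
        | lexBy-∷ cmpℕ a₂ rest (p ∸ p / 2) []
  with cmpℕ a₁ (p / 2) | cmpℕ-view a₁ (p / 2)
... | lt | _ = inj₁ refl
... | gt | vgt half<a₁ =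
  ⊥-elim (<⇒≱ half<a₁ (m+m≤n⇒m≤n/2 (≤-trans (+-monoʳ-≤ a₁ a₁≤a₂) (first-two≤sum a₁ a₂ rest sum≡p))))
... | eq | veq refl with cmpℕ a₂ (p ∸ p / 2) | cmpℕ-view a₂ (p ∸ p / 2)
...   | lt | _ = inj₁ refl
...   | gt | vgt p∸half<a₂ =
  ⊥-elim (<⇒≱ p∸half<a₂ (m+n≤o⇒m≤o∸n a₂ (subst (_≤ p) (+-comm a₁ a₂) (first-two≤sum a₁ a₂ rest sum≡p))))
...   | eq | veq refl = inj₂ (cong (λ r → p / 2 ∷ p ∸ p / 2 ∷ r) (sum≡0⇒[] rest-pos sum-rest≡0))
  where
  sum-rest≡0 : sum rest ≡ 0
  sum-rest≡0 = +-cancelˡ-≡ p (sum rest) 0 (begin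
    p + sum rest                    ≡⟨ cong (_+ sum rest) (m+[n∸m]≡n half≤p) ⟨
    p / 2 + (p ∸ p / 2) + sum rest  ≡⟨ +-assoc (p / 2) (p ∸ p / 2) (sum rest) ⟩
    p / 2 + (p ∸ p / 2 + sum rest)  ≡⟨ sum≡p ⟩
    p                               ≡⟨ +-identityʳ p ⟨
    p + 0                           ∎)
    where
    open ≡-Reasoning
    half≤p : p / 2 ≤ p
    half≤p = ≤-trans (m≤m+n (p / 2) (p / 2)) (n/2+n/2≤n p)
maxPart-greatest {a = _ ∷ []} record { two≤length = s≤s () }

ndSeqs-sound : ∀ f r m {b} → b ∈ ndSeqs f r m → sum b ≡ r × Linked _≤_ (m ∷ b)
ndSeqs-sound f zero m (here refl) = refl , [-]
ndSeqs-sound (suc f) (suc r) m b∈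
  with find (∈-concatMap⁻ (λ a → map (a ∷_) (ndSeqs f (suc r ∸ a) a))
                          {xs = filter (m ≤?_) (map suc (upTo (suc r)))} b∈)
... | a , a∈ , b∈a∷ with ∈-filter⁻ (m ≤?_) {xs = map suc (upTo (suc r))} a∈ | ∈-map⁻ (a ∷_) b∈a∷
... | a∈suc , m≤a | b′ , b′∈ , refl with ∈-map⁻ suc a∈suc
... | i , i∈ , refl with ndSeqs-sound f (suc r ∸ suc i) (suc i) b′∈
... | sum≡ , sorted = trans (cong (suc i +_) sum≡) (m+[n∸m]≡n (∈-upTo⁻ i∈)) , m≤a ∷ sorted

∈-suc-upTo : ∀ {a r} → 1 ≤ a → a ≤ suc r → a ∈ map suc (upTo (suc r))
∈-suc-upTo {suc i} _ (s≤s i≤r) = ∈-map⁺ suc (∈-upTo⁺ (s≤s i≤r))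

∈-ndSeqs-singleton : ∀ f {c m} → 1 ≤ c → m ≤ c → (c ∷ []) ∈ ndSeqs (suc f) c m
∈-ndSeqs-singleton f {suc r} {m} _ m≤c =
  ∈-concatMap⁺ (λ a → map (a ∷_) (ndSeqs f (suc r ∸ a) a))
    (lose (∈-filter⁺ (m ≤?_) (∈-suc-upTo (s≤s z≤n) ≤-refl) m≤c)
          (∈-map⁺ (suc r ∷_) (subst (λ z → [] ∈ ndSeqs f z (suc r)) (sym (n∸n≡0 r)) (here refl))))

maxPart∈allParts : ∀ p → 2 ≤ p → maxPart p ∈ allParts p
maxPart∈allParts p@(suc (suc f)) (s≤s (s≤s z≤n)) =
  ∈-filter⁺ (λ a → 2 ≤? length a) max∈ (s≤s (s≤s z≤n))
  where
  1≤half : 1 ≤ p / 2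
  1≤half = /-monoˡ-≤ 2 (s≤s (s≤s (z≤n {f})))
  max∈ : maxPart p ∈ ndSeqs p p 1
  max∈ = ∈-concatMap⁺ (λ a → map (a ∷_) (ndSeqs (suc f) (p ∸ a) a))
    (lose (∈-filter⁺ (1 ≤?_) (∈-suc-upTo 1≤half (≤-trans (m≤m+n (p / 2) (p / 2)) (n/2+n/2≤n p))) 1≤half)
          (∈-map⁺ (p / 2 ∷_)
            (∈-ndSeqs-singleton f (m+n≤o⇒m≤o∸n 1 (≤-trans (+-monoˡ-≤ (p / 2) 1≤half) (n/2+n/2≤n p)))
                                  (m+n≤o⇒m≤o∸n (p / 2) (n/2+n/2≤n p)))))

lexMin-∈ : ∀ {xs b} → lexMin xs ≡ just b → b ∈ xs
lexMin-∈ {x ∷ xs} e with lexMin xs in e′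
lexMin-∈ {x ∷ xs} refl | nothing = here refl
... | just b′ with isLt (lexℕ b′ x)
lexMin-∈ {x ∷ xs} refl | just b′ | true = there (lexMin-∈ e′)
lexMin-∈ {x ∷ xs} refl | just b′ | false = here refl

lexMin-∷ : ∀ x xs → ∃ λ b → lexMin (x ∷ xs) ≡ just b
lexMin-∷ x xs with lexMin xs
... | nothing = x , refl
... | just b′ with isLt (lexℕ b′ x)
...   | true = b′ , refl
...   | false = x , refl

isLt⇒≡lt : ∀ {c} → isLt c ≡ true → c ≡ lt
isLt⇒≡lt {lt} _ = refl

nextPart-sound : ∀ {p a b} → nextPart p a ≡ just b → lexℕ a b ≡ lt × IsPart p b
nextPart-sound {p} {a} {b} e
  with ∈-filter⁻ (λ b → Bool._≟_ (isLt (lexℕ a b)) true) {xs = allParts p} (lexMin-∈ e)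
... | b∈ , a<b with ∈-filter⁻ (λ b → 2 ≤? length b) {xs = ndSeqs p p 1} b∈
... | b∈nd , two≤ with ndSeqs-sound p p 1 b∈nd
... | sum≡ , 1∷b-sorted =
  isLt⇒≡lt a<b ,
  record { nondecreasing = Linked.tail 1∷b-sorted
         ; positive = AllPairs.head (Linked.Linked⇒AllPairs ≤-trans 1∷b-sorted)
         ; two≤length = two≤ ; sum≡ = sum≡ }

nextPart-exists : ∀ {p a} → 2 ≤ p → lexℕ a (maxPart p) ≡ lt → ∃ λ b → nextPart p a ≡ just b
nextPart-exists {p} {a} two≤p a<max
  with filter (λ b → Bool._≟_ (isLt (lexℕ a b)) true) (allParts p)
     | ∈-filter⁺ (λ b → Bool._≟_ (isLt (lexℕ a b)) true) {xs = allParts p}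
                 (maxPart∈allParts p two≤p) (cong isLt a<max)
... | x ∷ xs | _ = lexMin-∷ x xs

leavesL-map : ∀ {cs ds} → map leaves cs ≡ map leaves ds → leavesL cs ≡ leavesL ds
leavesL-map {cs} {ds} same = trans (leavesL≡sum cs) (trans (cong sum same) (sym (leavesL≡sum ds)))

length-map-leaves : ∀ {cs ds} → map leaves cs ≡ map leaves ds → length cs ≡ length ds
length-map-leaves {cs} {ds} same =
  trans (sym (length-map leaves cs)) (trans (cong length same) (length-map leaves ds))

induced-IsPart : ∀ {cs} → InT (node cs) → IsPart (leavesL cs) (induced (node cs))
induced-IsPart {cs} (nodeT two≤length ins) = record
  { nondecreasing = induced-nondecreasing cs
  ; positive      = All.map⁺ (All.map InT⇒leaves≥1 (All-resp-↭ (↭-sym sorted↭) ins))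
  ; two≤length    = subst (2 ≤_) (sym (trans (length-map leaves (sortedChildren cs)) (↭-length sorted↭)))
                          two≤length
  ; sum≡          = trans (sym (leavesL≡sum (sortedChildren cs))) (leavesL-↭ sorted↭)
  }
  where
  sorted↭ : sortedChildren cs ↭ cs
  sorted↭ = sortBy-↭ cmpT cs

leaves<⇒≤T : ∀ {v w} → leaves v < leaves w → v ≤T w
leaves<⇒≤T {v} {w} fewer = <T⇒≤T {v} {w} (cmpT-< {v} {w} fewer)

leavesL-replicate-leaf : ∀ k → leavesL (replicate k leaf) ≡ k
leavesL-replicate-leaf zero = refl
leavesL-replicate-leaf (suc k) = cong suc (leavesL-replicate-leaf k)

flat-Ordered : ∀ {k} → 2 ≤ k → Ordered (flat k)
flat-Ordered {k} two≤k =
  nodeO (subst (2 ≤_) (sym (length-replicate k)) two≤k) (leaves-ordered k) (leaves-sorted k)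
  where
  leaves-ordered : ∀ k → All Ordered (replicate k leaf)
  leaves-ordered zero = []
  leaves-ordered (suc k) = leafO ∷ leaves-ordered k
  leaves-sorted : ∀ k → Linked _≤T_ (replicate k leaf)
  leaves-sorted zero = []
  leaves-sorted (suc zero) = [-]
  leaves-sorted (suc (suc k)) = ≤T-refl leaf ∷ leaves-sorted (suc k)

part→child-leaves : ∀ {b} → 1 ≤ b → leaves (part→child b) ≡ b
part→child-leaves {suc zero} _ = refl
part→child-leaves {suc (suc k)} _ = leavesL-replicate-leaf (suc (suc k))

part→child-Ordered : ∀ {b} → 1 ≤ b → Ordered (part→child b)
part→child-Ordered {suc zero} _ = leafO
part→child-Ordered {suc (suc k)} _ = flat-Ordered (s≤s (s≤s z≤n))

part→child-mono : ∀ {a b} → 1 ≤ a → a ≤ b → part→child a ≤T part→child b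
part→child-mono {a} {b} 1≤a a≤b with a ≟ b
... | yes refl = ≤T-refl (part→child a)
... | no a≢b = leaves<⇒≤T {part→child a} {part→child b}
  (subst₂ _<_ (sym (part→child-leaves 1≤a)) (sym (part→child-leaves (≤-trans 1≤a a≤b))) (≤∧≢⇒< a≤b a≢b))

module _ {p b} (b-part : IsPart p b) where
  open IsPart b-part

  part→children-leaves : map leaves (map part→child b) ≡ b
  part→children-leaves = go positive
    where
    go : ∀ {b} → All (1 ≤_) b → map leaves (map part→child b) ≡ b
    go [] = refl
    go (1≤b₁ ∷ pos) = cong₂ _∷_ (part→child-leaves 1≤b₁) (go pos)

  part→children-sorted : Linked _≤T_ (map part→child b)
  part→children-sorted = go nondecreasing positive
    where
    go : ∀ {b} → Linked _≤_ b → All (1 ≤_) b → Linked _≤T_ (map part→child b)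
    go [] _ = []
    go [-] _ = [-]
    go (b₁≤b₂ ∷ rest) (1≤b₁ ∷ pos) = part→child-mono 1≤b₁ b₁≤b₂ ∷ go rest pos

  part→children-Ordered : Ordered (node (map part→child b))
  part→children-Ordered =
    nodeO (subst (2 ≤_) (sym (length-map part→child b)) two≤length)
          (All.map⁺ (All.map part→child-Ordered positive))
          part→children-sorted

fixSibling-cases : ∀ c y → (leaves y ≡ leaves c × fixSibling c y ≡ c)
                        ⊎ (leaves y ≢ leaves c × fixSibling c y ≡ flat (leaves y))
fixSibling-cases c y with leaves y ≡ᵇ leaves c in e
... | true  = inj₁ (≡ᵇ⇒≡ _ _ (subst T (sym e) tt) , refl)
... | false = inj₂ ((λ same → subst T e (≡⇒≡ᵇ _ _ same)) , refl)

fixSibling-self : ∀ c → fixSibling c c ≡ c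
fixSibling-self c with fixSibling-cases c c
... | inj₁ (_ , fixed) = fixed
... | inj₂ (differ , _) = ⊥-elim (differ refl)

fixSibling-leaves : ∀ c y → leaves (fixSibling c y) ≡ leaves y
fixSibling-leaves c y with fixSibling-cases c y
... | inj₁ (same , fixed) = trans (cong leaves fixed) (sym same)
... | inj₂ (_ , fixed) = trans (cong leaves fixed) (leavesL-replicate-leaf (leaves y))

fixSibling-Ordered : ∀ {c y} → Ordered c → leaves c ≤ leaves y → Ordered (fixSibling c y)
fixSibling-Ordered {c} {y} c-ordered c≤y with fixSibling-cases c y
... | inj₁ (_ , fixed) = subst Ordered (sym fixed) c-ordered
... | inj₂ (differ , fixed) = subst Ordered (sym fixed)
  (flat-Ordered (≤-trans (s≤s (InT⇒leaves≥1 (Ordered⇒InT c-ordered)))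
                         (≤∧≢⇒< c≤y (λ same → differ (sym same)))))

fixSibling-mono : ∀ c {y z} → leaves y ≤ leaves z → fixSibling c y ≤T fixSibling c z
fixSibling-mono c {y} {z} y≤z with leaves y ≟ leaves z
... | yes same = subst (fixSibling c y ≤T_) (cong (λ l → if l ≡ᵇ leaves c then c else flat l) same)
                       (≤T-refl (fixSibling c y))
... | no y≢z = leaves<⇒≤T {fixSibling c y} {fixSibling c z}
  (subst₂ _<_ (sym (fixSibling-leaves c y)) (sym (fixSibling-leaves c z)) (≤∧≢⇒< y≤z y≢z))

fixSiblings-leaves : ∀ c ys → map leaves (map (fixSibling c) ys) ≡ map leaves ys
fixSiblings-leaves c ys =
  trans (sym (map-∘ {g = leaves} {f = fixSibling c} ys)) (map-cong (fixSibling-leaves c) ys)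

fixSiblings-Ordered : ∀ {c ys} → Ordered c → All (λ y → leaves c ≤ leaves y) ys →
                      All Ordered (map (fixSibling c) ys)
fixSiblings-Ordered c-ordered c≤ys = All.map⁺ (All.map (λ {y} → fixSibling-Ordered {y = y} c-ordered) c≤ys)

fixSiblings-sorted : ∀ {c ys} → Linked (_≤_ on leaves) (c ∷ ys) → Linked _≤T_ (c ∷ map (fixSibling c) ys)
fixSiblings-sorted {c} {ys} sorted =
  subst (λ t → Linked _≤T_ (t ∷ map (fixSibling c) ys)) (fixSibling-self c)
        (Linked.map⁺ (Linked.map (λ {y} {z} → fixSibling-mono c {y} {z}) sorted))

-- NextTree moves strictly up

record OrderedAbove (t t′ : Tree) : Set where
  field
    ordered     : Ordered t′
    same-leaves : leaves t′ ≡ leaves t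
    above       : cmpT t t′ ≡ lt

record OrderedAboveL (cs cs′ : List Tree) : Set where
  field
    all-ordered    : All Ordered cs′
    sorted         : Linked _≤T_ cs′
    same-partition : map leaves cs′ ≡ map leaves cs
    above          : lexBy cmpT cs cs′ ≡ lt

∷-aboveL : ∀ {c cs cs′} → Ordered c → Linked _≤T_ (c ∷ cs) → OrderedAboveL cs cs′ →
           OrderedAboveL (c ∷ cs) (c ∷ cs′)
∷-aboveL {cs = []} {[]} _ _ record { above = () }
∷-aboveL {c} {h ∷ t} {h′ ∷ t′} c-ordered (c≤h ∷ _) tail-above = record
  { all-ordered = c-ordered ∷ all-ordered
  ; sorted = ≤T-trans {c} {h} {h′} c≤h (lexBy-lt⇒head≢gt cmpT {h} {t} {h′} {t′} above) ∷ sorted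
  ; same-partition = cong (leaves c ∷_) same-partition
  ; above = begin
      lexBy cmpT (c ∷ h ∷ t) (c ∷ h′ ∷ t′)               ≡⟨ lexBy-∷ cmpT c (h ∷ t) c (h′ ∷ t′) ⟩
      lexStep (cmpT c c) (lexBy cmpT (h ∷ t) (h′ ∷ t′))  ≡⟨ cong (λ r → lexStep r _) (cmpT-refl c) ⟩
      lexBy cmpT (h ∷ t) (h′ ∷ t′)                       ≡⟨ above ⟩
      lt                                                 ∎
  }
  where open OrderedAboveL tail-above
        open ≡-Reasoning

fixSiblings-aboveL : ∀ {c c′ cs} → Linked _≤T_ (c ∷ cs) → OrderedAbove c c′ →
              OrderedAboveL (c ∷ cs) (c′ ∷ map (fixSibling c′) cs)
fixSiblings-aboveL {c} {c′} {cs} c∷cs-sorted c-above = record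
  { all-ordered = ordered ∷ fixSiblings-Ordered ordered
                              (AllPairs.head (Linked.Linked⇒AllPairs ≤-trans c′∷cs-leaves-sorted))
  ; sorted = fixSiblings-sorted c′∷cs-leaves-sorted
  ; same-partition = cong₂ _∷_ same-leaves (fixSiblings-leaves c′ cs)
  ; above = trans (lexBy-∷ cmpT c cs c′ (map (fixSibling c′) cs))
                  (cong (λ r → lexStep r (lexBy cmpT cs (map (fixSibling c′) cs))) above)
  }
  where
  open OrderedAbove c-above
  c′∷cs-leaves-sorted : Linked (_≤_ on leaves) (c′ ∷ cs)
  c′∷cs-leaves-sorted = Linked-replace-head (subst (_≤ _) (sym same-leaves))
                          (Linked.map (λ {x} {y} → ≤T⇒leaves≤ {x} {y}) c∷cs-sorted)

mutual
  next-above : ∀ {t t′} → Ordered t → next t ≡ just t′ → OrderedAbove t t′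
  next-above {node cs} (nodeO two≤length cs-ordered cs-sorted) e with nextL cs in eL
  next-above {node cs} (nodeO two≤length cs-ordered cs-sorted) refl | just cs′ = record
    { ordered = nodeO (subst (2 ≤_) (sym (length-map-leaves same-partition)) two≤length) all-ordered sorted
    ; same-leaves = leavesL-map same-partition
    ; above = trans (cmpT-ordered-nodes cs-sorted sorted (sym (leavesL-map same-partition)) not-one)
                    (cong₂ lexStep (trans (cong (lexℕ (map leaves cs)) same-partition) (lexℕ-refl (map leaves cs)))
                                   above)
    }
    where
    open OrderedAboveL (nextL-above cs-ordered cs-sorted eL)
    not-one : leavesL cs ≢ 1
    not-one = 2≤⇒≢1 (node-leaves≥2 two≤length (All-Ordered⇒InT cs-ordered))
  ... | nothing with exhausted (node cs)
  ...   | false with nextPart (leavesL cs) (induced (node cs)) in eP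
  next-above {node cs} (nodeO two≤length cs-ordered cs-sorted) refl | nothing | false | just b = record
    { ordered = part→children-Ordered b-part
    ; same-leaves = b-leaves
    ; above = trans (cmpT-ordered-nodes cs-sorted (part→children-sorted b-part) (sym b-leaves) not-one)
                    (cong (λ r → lexStep r (lexBy cmpT cs (map part→child b)))
                          (trans (cong₂ lexℕ (sym (induced-ordered cs-sorted)) (part→children-leaves b-part)) cs<b))
    }
    where
    not-one : leavesL cs ≢ 1
    not-one = 2≤⇒≢1 (node-leaves≥2 two≤length (All-Ordered⇒InT cs-ordered))
    cs<b : lexℕ (induced (node cs)) b ≡ lt
    cs<b = proj₁ (nextPart-sound {leavesL cs} {induced (node cs)} eP)
    b-part : IsPart (leavesL cs) b
    b-part = proj₂ (nextPart-sound {leavesL cs} {induced (node cs)} eP)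
    b-leaves : leavesL (map part→child b) ≡ leavesL cs
    b-leaves = trans (leavesL≡sum (map part→child b))
                     (trans (cong sum (part→children-leaves b-part)) (IsPart.sum≡ b-part))

  nextL-above : ∀ {cs cs′} → All Ordered cs → Linked _≤T_ cs → nextL cs ≡ just cs′ → OrderedAboveL cs cs′
  nextL-above {c ∷ cs} (c-ordered ∷ cs-ordered) c∷cs-sorted e with nextL cs in eL
  nextL-above {c ∷ cs} (c-ordered ∷ cs-ordered) c∷cs-sorted refl | just cs′ =
    ∷-aboveL c-ordered c∷cs-sorted (nextL-above cs-ordered (Linked.tail c∷cs-sorted) eL)
  ... | nothing with next c in eC
  nextL-above {c ∷ cs} (c-ordered ∷ cs-ordered) c∷cs-sorted refl | nothing | just c′ =
    fixSiblings-aboveL c∷cs-sorted (next-above c-ordered eC)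

-- A tree without pivot is maximal

data AllExhausted : Tree → Set where
  leafE : AllExhausted leaf
  nodeE : ∀ {cs} → All AllExhausted cs → exhausted (node cs) ≡ true → AllExhausted (node cs)

exhausted-node⇒≡maxPart : ∀ {cs} → exhausted (node cs) ≡ true → induced (node cs) ≡ maxPart (leavesL cs)
exhausted-node⇒≡maxPart {cs} e with lexℕ (induced (node cs)) (maxPart (leavesL cs)) in eq′
exhausted-node⇒≡maxPart {cs} refl | eq = lexℕ-eq⇒≡ _ _ eq′

≡maxPart⇒exhausted-node : ∀ {cs} → induced (node cs) ≡ maxPart (leavesL cs) → exhausted (node cs) ≡ true
≡maxPart⇒exhausted-node {cs} is-max
  rewrite is-max | lexℕ-refl (maxPart (leavesL cs)) = refl

nextL≡nothing : ∀ {cs} → nextL cs ≡ nothing → All (λ c → next c ≡ nothing) cs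
nextL≡nothing {[]} _ = []
nextL≡nothing {c ∷ cs} e with nextL cs in eL
... | nothing with next c in eC
...   | nothing = eC ∷ nextL≡nothing eL

mutual
  next≡nothing⇒AllExhausted : ∀ {t} → Ordered t → next t ≡ nothing → AllExhausted t
  next≡nothing⇒AllExhausted leafO _ = leafE
  next≡nothing⇒AllExhausted {node cs} (nodeO two≤length cs-ordered cs-sorted) e with nextL cs in eL
  ... | nothing with exhausted (node cs) in ex
  ...   | true = nodeE (All-next≡nothing⇒AllExhausted cs-ordered (nextL≡nothing eL)) ex
  ...   | false with nextPart (leavesL cs) (induced (node cs)) in eP
  ...     | nothing
    with maxPart-greatest (induced-IsPart (Ordered⇒InT (nodeO two≤length cs-ordered cs-sorted)))
  ...       | inj₂ is-max with trans (sym ex) (≡maxPart⇒exhausted-node {cs} is-max)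
  ...         | ()
  next≡nothing⇒AllExhausted {node cs} (nodeO two≤length cs-ordered cs-sorted) e
    | nothing | false | nothing | inj₁ below-max
    with nextPart-exists {leavesL cs} {induced (node cs)}
                         (node-leaves≥2 two≤length (All-Ordered⇒InT cs-ordered)) below-max
  ...         | b , eb with trans (sym eP) eb
  ...           | ()

  All-next≡nothing⇒AllExhausted : ∀ {cs} → All Ordered cs → All (λ c → next c ≡ nothing) cs →
                                  All AllExhausted cs
  All-next≡nothing⇒AllExhausted [] [] = []
  All-next≡nothing⇒AllExhausted (o ∷ os) (e ∷ es) =
    next≡nothing⇒AllExhausted o e ∷ All-next≡nothing⇒AllExhausted os es

mutual
  AllExhausted⇒maximum : ∀ {t t′} → Ordered t → AllExhausted t → InT t′ → leaves t′ ≡ leaves t → t′ ≤T t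
  AllExhausted⇒maximum {leaf} {leaf} _ _ _ _ = ≤T-refl leaf
  AllExhausted⇒maximum {leaf} {node ds} _ _ (nodeT two≤length ins) one =
    ⊥-elim (2≤⇒≢1 (node-leaves≥2 two≤length ins) one)
  AllExhausted⇒maximum {node cs} {leaf} (nodeO two≤length os _) _ _ one =
    ⊥-elim (2≤⇒≢1 (node-leaves≥2 two≤length (All-Ordered⇒InT os)) (sym one))
  AllExhausted⇒maximum {node cs} {node ds} (nodeO two≤length os cs-sorted) (nodeE cs-exhausted ex)
                       ds-InT same =
    subst (_≢ gt) (sym unfolded) (compare (subst (λ m → lexℕ ds-part m ≡ lt ⊎ ds-part ≡ m) (sym cs-max)
                                                  (maxPart-greatest ds-IsPart)))
    where
    ds-part = induced (node ds)
    ds-IsPart : IsPart (leavesL cs) ds-part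
    ds-IsPart = subst (λ p → IsPart p ds-part) same (induced-IsPart ds-InT)
    not-one : leavesL ds ≢ 1
    not-one = 2≤⇒≢1 (subst (2 ≤_) (sym same) (node-leaves≥2 two≤length (All-Ordered⇒InT os)))
    unfolded : cmpT (node ds) (node cs) ≡
               lexStep (lexℕ ds-part (map leaves cs)) (lexBy cmpT (sortedChildren ds) cs)
    unfolded = trans (cmpT-node ds cs same not-one)
                     (cong (λ cs′ → lexStep (lexℕ ds-part (map leaves cs′)) (lexBy cmpT (sortedChildren ds) cs′))
                           (sortedChildren-ordered cs-sorted))
    cs-max : map leaves cs ≡ maxPart (leavesL cs)
    cs-max = trans (sym (induced-ordered cs-sorted)) (exhausted-node⇒≡maxPart {cs} ex)
    children-InT : All InT (sortedChildren ds)
    children-InT = All-resp-↭ (↭-sym (sortBy-↭ cmpT ds)) (InT-children ds-InT)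
    compare : lexℕ ds-part (map leaves cs) ≡ lt ⊎ ds-part ≡ map leaves cs →
              lexStep (lexℕ ds-part (map leaves cs)) (lexBy cmpT (sortedChildren ds) cs) ≢ gt
    compare (inj₁ below) rewrite below = λ ()
    compare (inj₂ same-partition) rewrite same-partition | lexℕ-refl (map leaves cs) =
      AllExhausted⇒maximumL same-partition children-InT os cs-exhausted

  AllExhausted⇒maximumL : ∀ {ds cs} → map leaves ds ≡ map leaves cs → All InT ds → All Ordered cs →
               All AllExhausted cs → lexBy cmpT ds cs ≢ gt
  AllExhausted⇒maximumL {[]} {[]} _ _ _ _ = λ ()
  AllExhausted⇒maximumL {d ∷ ds} {c ∷ cs} same (i ∷ is) (o ∷ os) (x ∷ xs)
    rewrite lexBy-∷ cmpT d ds c cs =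
    lexStep-≢gt (AllExhausted⇒maximum o x i (∷-injectiveˡ same))
                (AllExhausted⇒maximumL (∷-injectiveʳ same) is os xs)

lemma3 : (n : ℕ) → 1 ≤ n → (T : Tree) → Ordered T → leaves T ≡ n → ¬ IsMax n T →
    Σ Tree (λ T' → (NextTree T ≡ just T') × Ordered T' × (leaves T' ≡ n))
lemma3 n _ T T-ordered leaves≡n not-max with next T in e
... | just T′ = T′ , refl , ordered , trans same-leaves leaves≡n
  where open OrderedAbove (next-above T-ordered e)
... | nothing = ⊥-elim (not-max λ T′ T′-InT leaves′≡n →
  AllExhausted⇒maximum T-ordered (next≡nothing⇒AllExhausted T-ordered e) T′-InT
                       (trans leaves′≡n (sym leaves≡n)))
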